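{- For all $\alpha,\beta\in S_c[X]$: $\alpha\vdash\beta$ if and only if $\alpha\rightarrow\beta=1$, where $\alpha\rightarrow\beta:=\alpha^c\circ\beta$.
   Context: A semiring is a set with operations $\circ$ (commutative monoid, identity $\theta$) and $\cdot$ (monoid, identity $1$), $\cdot$ distributing over $\circ$ on both sides, $\theta$ absorbing for $\cdot$, $1\ne\theta$. An I-C semiring is a commutative semiring in which every $s$ has an element $s^c$ with $s\cdot s^c=\theta$, $s\circ s^c=1$, $s\cdot s=s$, $s\circ s=s$. $X=\{x_1,x_2,\dots\}$ is countable and $S_c[X]$ is the free I-C semiring generated by $X$, constructed as the direct limit of the semirings $S_c[X_N]$, where $S_c[X_N]$ is the quotient of the free commutative semiring on $\{x_1,\dots,x_N,x_1^c,\dots,x_N^c\}$ by the congruence generated by $(x_i\cdot x_i^c,\theta)$, $(x_i\circ x_i^c,1)$, $(x_i\circ x_i,x_i)$, $(x_i^c\circ x_i^c,x_i^c)$, along the homomorphisms induced by $x_i\mapsto x_i$, $x_i^c\mapsto x_i^c$. For $\alpha\in S_c[X]$, $\alpha^c$ is its complement. For $\Gamma\subseteq S_c[X]$ let $\equiv_\Gamma$ be the congruence on $S_c[X]$ generated by $\{(\gamma,1):\gamma\in\Gamma\}$; $\Gamma\vdash\beta$ means $\beta\equiv_\Gamma1$, and $\alpha\vdash\beta$ means $\{\alpha\}\vdash\beta$. -}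

module Defs where

open import Data.Nat using (ℕ)
open import Level using (0ℓ)
open import Data.Product using (_×_)
open import Relation.Unary using (Pred; ∅; ｛_｝)

-- Generators of the free commutative semiring: x_i and x_i^c, i ∈ ℕ
-- (X = {x_1, x_2, ...} countable; indexing from 0 is immaterial).
data Gen : Set where
  x  : ℕ → Gen
  xc : ℕ → Gen

infixl 6 _∘_
infixl 7 _·_
data Term : Set where
  gen : Gen → Term
  θ   : Term
  𝟙   : Term
  _∘_ : Term → Term → Term
  _·_ : Term → Term → Term

-- With Γ = ∅ this is the equality of S_c[X]; in general it is ≡_Γ on S_c[X]
-- (pulled back to representing terms).
data Derive (Γ : Pred Term 0ℓ) : Term → Term → Set where
  refl  : ∀ {a} → Derive Γ a a
  sym   : ∀ {a b} → Derive Γ a b → Derive Γ b a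
  trans : ∀ {a b c} → Derive Γ a b → Derive Γ b c → Derive Γ a c
  ∘-cong : ∀ {a a′ b b′} → Derive Γ a a′ → Derive Γ b b′ → Derive Γ (a ∘ b) (a′ ∘ b′)
  ·-cong : ∀ {a a′ b b′} → Derive Γ a a′ → Derive Γ b b′ → Derive Γ (a · b) (a′ · b′)
  ∘-assoc    : ∀ a b c → Derive Γ ((a ∘ b) ∘ c) (a ∘ (b ∘ c))
  ∘-comm     : ∀ a b → Derive Γ (a ∘ b) (b ∘ a)
  ∘-identity : ∀ a → Derive Γ (θ ∘ a) a
  ·-assoc    : ∀ a b c → Derive Γ ((a · b) · c) (a · (b · c))
  ·-comm     : ∀ a b → Derive Γ (a · b) (b · a)
  ·-identity : ∀ a → Derive Γ (𝟙 · a) a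
  -- distributivity (the right-hand law follows by commutativity) and absorption of θ
  distrib : ∀ a b c → Derive Γ (a · (b ∘ c)) ((a · b) ∘ (a · c))
  θ-zero  : ∀ a → Derive Γ (θ · a) θ
  rel-·c : ∀ i → Derive Γ (gen (x i) · gen (xc i)) θ
  rel-∘c : ∀ i → Derive Γ (gen (x i) ∘ gen (xc i)) 𝟙
  rel-∘x : ∀ i → Derive Γ (gen (x i) ∘ gen (x i)) (gen (x i))
  rel-∘xc : ∀ i → Derive Γ (gen (xc i) ∘ gen (xc i)) (gen (xc i))
  hyp : ∀ {γ} → Γ γ → Derive Γ γ 𝟙

infix 4 _≈_ _⊢_
_≈_ : Term → Term → Set
a ≈ b = Derive ∅ a b

_⊩_ : Pred Term 0ℓ → Term → Set
Γ ⊩ β = Derive Γ β 𝟙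

_⊢_ : Term → Term → Set
α ⊢ β = ｛ α ｝ ⊩ β

IsComplement : Term → Term → Set
IsComplement α γ = (α · γ ≈ θ) × (α ∘ γ ≈ 𝟙)

_⇒[_]_ : Term → Term → Term → Term
α ⇒[ αc ] β = αc ∘ β

{-# OPTIONS --safe #-}
-- Since α is idempotent, t ↦ α · t preserves ∘ and ·, and it identifies α with 𝟙; so its kernel is a
-- congruence containing (α , 𝟙), and α ⊢ β gives α · β ≈ α. Splitting β ≈ α · β ∘ αᶜ · β then yields
-- αᶜ ∘ β ≈ (αᶜ ∘ α) ∘ αᶜ · β ≈ 𝟙, because 𝟙 is absorbing for ∘. Conversely, modulo α ≡ 𝟙 we have
-- αᶜ ≡ α · αᶜ ≈ θ, hence β ≡ αᶜ ∘ β ≈ 𝟙.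
module Submission where

open import Defs
open import Data.Product using (_×_; _,_)
open import Level using (0ℓ)
open import Relation.Binary.Bundles using (Setoid)
open import Relation.Binary.PropositionalEquality using (refl)
open import Relation.Unary using (Pred; ｛_｝)
import Relation.Binary.Reasoning.Setoid as SetoidReasoning

Derive-setoid : Pred Term 0ℓ → Setoid 0ℓ 0ℓ
Derive-setoid Γ = record
  { Carrier       = Term
  ; _≈_           = Derive Γ
  ; isEquivalence = record { refl = refl ; sym = sym ; trans = trans }
  }

module DeriveReasoning {Γ : Pred Term 0ℓ} = SetoidReasoning (Derive-setoid Γ)
open DeriveReasoning

≈⇒Derive : ∀ {Γ a b} → a ≈ b → Derive Γ a b
≈⇒Derive refl               = refl
≈⇒Derive (sym p)            = sym (≈⇒Derive p)
≈⇒Derive (trans p q)        = trans (≈⇒Derive p) (≈⇒Derive q)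
≈⇒Derive (∘-cong p q)       = ∘-cong (≈⇒Derive p) (≈⇒Derive q)
≈⇒Derive (·-cong p q)       = ·-cong (≈⇒Derive p) (≈⇒Derive q)
≈⇒Derive (∘-assoc a b c)    = ∘-assoc a b c
≈⇒Derive (∘-comm a b)       = ∘-comm a b
≈⇒Derive (∘-identity a)     = ∘-identity a
≈⇒Derive (·-assoc a b c)    = ·-assoc a b c
≈⇒Derive (·-comm a b)       = ·-comm a b
≈⇒Derive (·-identity a)     = ·-identity a
≈⇒Derive (distrib a b c)    = distrib a b c
≈⇒Derive (θ-zero a)         = θ-zero a
≈⇒Derive (rel-·c i)         = rel-·c i
≈⇒Derive (rel-∘c i)         = rel-∘c i
≈⇒Derive (rel-∘x i)         = rel-∘x i
≈⇒Derive (rel-∘xc i)        = rel-∘xc i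
≈⇒Derive (hyp ())

∘-identityʳ : ∀ {Γ} a → Derive Γ (a ∘ θ) a
∘-identityʳ a = trans (∘-comm a θ) (∘-identity a)

·-identityʳ : ∀ {Γ} a → Derive Γ (a · 𝟙) a
·-identityʳ a = trans (·-comm a 𝟙) (·-identity a)

𝟙-∘-zeroˡ : ∀ t → 𝟙 ∘ t ≈ 𝟙
𝟙-∘-zeroˡ (gen (x i)) = begin
  𝟙 ∘ gen (x i)                        ≈⟨ ∘-cong (rel-∘c i) refl ⟨
  (gen (x i) ∘ gen (xc i)) ∘ gen (x i) ≈⟨ ∘-comm _ _ ⟩
  gen (x i) ∘ (gen (x i) ∘ gen (xc i)) ≈⟨ ∘-assoc _ _ _ ⟨
  (gen (x i) ∘ gen (x i)) ∘ gen (xc i) ≈⟨ ∘-cong (rel-∘x i) refl ⟩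
  gen (x i) ∘ gen (xc i)               ≈⟨ rel-∘c i ⟩
  𝟙                                    ∎
𝟙-∘-zeroˡ (gen (xc i)) = begin
  𝟙 ∘ gen (xc i)                         ≈⟨ ∘-cong (rel-∘c i) refl ⟨
  (gen (x i) ∘ gen (xc i)) ∘ gen (xc i)  ≈⟨ ∘-assoc _ _ _ ⟩
  gen (x i) ∘ (gen (xc i) ∘ gen (xc i))  ≈⟨ ∘-cong refl (rel-∘xc i) ⟩
  gen (x i) ∘ gen (xc i)                 ≈⟨ rel-∘c i ⟩
  𝟙                                      ∎
𝟙-∘-zeroˡ θ = ∘-identityʳ 𝟙
𝟙-∘-zeroˡ 𝟙 = begin
  𝟙 ∘ 𝟙                          ≈⟨ ∘-cong refl (rel-∘c 0) ⟨
  𝟙 ∘ (gen (x 0) ∘ gen (xc 0))   ≈⟨ ∘-assoc _ _ _ ⟨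
  (𝟙 ∘ gen (x 0)) ∘ gen (xc 0)   ≈⟨ ∘-cong (𝟙-∘-zeroˡ (gen (x 0))) refl ⟩
  𝟙 ∘ gen (xc 0)                 ≈⟨ 𝟙-∘-zeroˡ (gen (xc 0)) ⟩
  𝟙                              ∎
𝟙-∘-zeroˡ (a ∘ b) = begin
  𝟙 ∘ (a ∘ b)  ≈⟨ ∘-assoc _ _ _ ⟨
  (𝟙 ∘ a) ∘ b  ≈⟨ ∘-cong (𝟙-∘-zeroˡ a) refl ⟩
  𝟙 ∘ b        ≈⟨ 𝟙-∘-zeroˡ b ⟩
  𝟙            ∎
𝟙-∘-zeroˡ (a · b) = begin
  𝟙 ∘ (a · b)              ≈⟨ ∘-cong (𝟙-∘-zeroˡ a) refl ⟨
  (𝟙 ∘ a) ∘ (a · b)        ≈⟨ ∘-assoc _ _ _ ⟩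
  𝟙 ∘ (a ∘ (a · b))        ≈⟨ ∘-cong refl (∘-cong (·-identityʳ a) refl) ⟨
  𝟙 ∘ ((a · 𝟙) ∘ (a · b))  ≈⟨ ∘-cong refl (distrib a 𝟙 b) ⟨
  𝟙 ∘ (a · (𝟙 ∘ b))        ≈⟨ ∘-cong refl (·-cong refl (𝟙-∘-zeroˡ b)) ⟩
  𝟙 ∘ (a · 𝟙)              ≈⟨ ∘-cong refl (·-identityʳ a) ⟩
  𝟙 ∘ a                    ≈⟨ 𝟙-∘-zeroˡ a ⟩
  𝟙                        ∎

module Idempotent {α : Term} (α·α≈α : α · α ≈ α) where

  ·-distribˡ-· : ∀ a b → α · (a · b) ≈ (α · a) · (α · b)
  ·-distribˡ-· a b = begin
    α · (a · b)        ≈⟨ ·-cong α·α≈α refl ⟨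
    (α · α) · (a · b)  ≈⟨ ·-assoc _ _ _ ⟩
    α · (α · (a · b))  ≈⟨ ·-cong refl (·-assoc _ _ _) ⟨
    α · ((α · a) · b)  ≈⟨ ·-cong refl (·-cong (·-comm _ _) refl) ⟩
    α · ((a · α) · b)  ≈⟨ ·-cong refl (·-assoc _ _ _) ⟩
    α · (a · (α · b))  ≈⟨ ·-assoc _ _ _ ⟨
    (α · a) · (α · b)  ∎

  Derive⇒α·-≈ : ∀ {a b} → Derive ｛ α ｝ a b → α · a ≈ α · b
  Derive⇒α·-≈ refl            = refl
  Derive⇒α·-≈ (sym p)         = sym (Derive⇒α·-≈ p)
  Derive⇒α·-≈ (trans p q)     = trans (Derive⇒α·-≈ p) (Derive⇒α·-≈ q)
  Derive⇒α·-≈ (∘-cong p q)    =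
    trans (distrib _ _ _) (trans (∘-cong (Derive⇒α·-≈ p) (Derive⇒α·-≈ q)) (sym (distrib _ _ _)))
  Derive⇒α·-≈ (·-cong p q)    =
    trans (·-distribˡ-· _ _) (trans (·-cong (Derive⇒α·-≈ p) (Derive⇒α·-≈ q)) (sym (·-distribˡ-· _ _)))
  Derive⇒α·-≈ (∘-assoc a b c) = ·-cong refl (∘-assoc a b c)
  Derive⇒α·-≈ (∘-comm a b)    = ·-cong refl (∘-comm a b)
  Derive⇒α·-≈ (∘-identity a)  = ·-cong refl (∘-identity a)
  Derive⇒α·-≈ (·-assoc a b c) = ·-cong refl (·-assoc a b c)
  Derive⇒α·-≈ (·-comm a b)    = ·-cong refl (·-comm a b)
  Derive⇒α·-≈ (·-identity a)  = ·-cong refl (·-identity a)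
  Derive⇒α·-≈ (distrib a b c) = ·-cong refl (distrib a b c)
  Derive⇒α·-≈ (θ-zero a)      = ·-cong refl (θ-zero a)
  Derive⇒α·-≈ (rel-·c i)      = ·-cong refl (rel-·c i)
  Derive⇒α·-≈ (rel-∘c i)      = ·-cong refl (rel-∘c i)
  Derive⇒α·-≈ (rel-∘x i)      = ·-cong refl (rel-∘x i)
  Derive⇒α·-≈ (rel-∘xc i)     = ·-cong refl (rel-∘xc i)
  Derive⇒α·-≈ (hyp refl)      = trans α·α≈α (sym (·-identityʳ α))

  ⊢⇒α·≈α : ∀ {β} → α ⊢ β → α · β ≈ α
  ⊢⇒α·≈α p = trans (Derive⇒α·-≈ p) (·-identityʳ α)

module Complement {α αc : Term} (α·αc≈θ : α · αc ≈ θ) (α∘αc≈𝟙 : α ∘ αc ≈ 𝟙) where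

  idempotent : α · α ≈ α
  idempotent = begin
    α · α                ≈⟨ ∘-identityʳ _ ⟨
    (α · α) ∘ θ          ≈⟨ ∘-cong refl α·αc≈θ ⟨
    (α · α) ∘ (α · αc)   ≈⟨ distrib α α αc ⟨
    α · (α ∘ αc)         ≈⟨ ·-cong refl α∘αc≈𝟙 ⟩
    α · 𝟙                ≈⟨ ·-identityʳ α ⟩
    α                    ∎

  split : ∀ β → β ≈ (α · β) ∘ (αc · β)
  split β = begin
    β                      ≈⟨ ·-identity β ⟨
    𝟙 · β                  ≈⟨ ·-cong α∘αc≈𝟙 refl ⟨
    (α ∘ αc) · β           ≈⟨ ·-comm _ _ ⟩
    β · (α ∘ αc)           ≈⟨ distrib _ _ _ ⟩
    (β · α) ∘ (β · αc)     ≈⟨ ∘-cong (·-comm _ _) (·-comm _ _) ⟩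
    (α · β) ∘ (αc · β)     ∎

  ⊢⇒⇒≈𝟙 : ∀ {β} → α ⊢ β → α ⇒[ αc ] β ≈ 𝟙
  ⊢⇒⇒≈𝟙 {β} α⊢β = begin
    αc ∘ β                     ≈⟨ ∘-cong refl (split β) ⟩
    αc ∘ ((α · β) ∘ (αc · β))  ≈⟨ ∘-cong refl (∘-cong (Idempotent.⊢⇒α·≈α idempotent α⊢β) refl) ⟩
    αc ∘ (α ∘ (αc · β))        ≈⟨ ∘-assoc _ _ _ ⟨
    (αc ∘ α) ∘ (αc · β)        ≈⟨ ∘-cong (trans (∘-comm _ _) α∘αc≈𝟙) refl ⟩
    𝟙 ∘ (αc · β)               ≈⟨ 𝟙-∘-zeroˡ _ ⟩
    𝟙                          ∎

  complement-Derive-θ : Derive ｛ α ｝ αc θ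
  complement-Derive-θ = begin
    αc      ≈⟨ ·-identity αc ⟨
    𝟙 · αc  ≈⟨ ·-cong (hyp refl) refl ⟨
    α · αc  ≈⟨ ≈⇒Derive α·αc≈θ ⟩
    θ       ∎

  ⇒≈𝟙⇒⊢ : ∀ {β} → α ⇒[ αc ] β ≈ 𝟙 → α ⊢ β
  ⇒≈𝟙⇒⊢ {β} αc∘β≈𝟙 = begin
    β       ≈⟨ ∘-identity β ⟨
    θ ∘ β   ≈⟨ ∘-cong complement-Derive-θ refl ⟨
    αc ∘ β  ≈⟨ ≈⇒Derive αc∘β≈𝟙 ⟩
    𝟙       ∎

proposition4p10 : (α β αc : Term) → IsComplement α αc →
    ((α ⊢ β → α ⇒[ αc ] β ≈ 𝟙) × (α ⇒[ αc ] β ≈ 𝟙 → α ⊢ β))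
proposition4p10 α β αc (α·αc≈θ , α∘αc≈𝟙) = ⊢⇒⇒≈𝟙 , ⇒≈𝟙⇒⊢
  where open Complement α·αc≈θ α∘αc≈𝟙
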